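{- Let $p$ be a prime, $q=p^a$, $0\le m\le n$, and let $A=\{\mathbf a_1,\dots,\mathbf a_N\}\subseteq\mathbb Z^m\times\mathbb N^{n-m}$ be such that for each $j\in\{m+1,\dots,n\}$ some $\mathbf a_i$ has nonzero $j$-th coordinate. Let $\mathbf e=(e_1,\dots,e_m,0,\dots,0)\in\mathbb Z^n$, $M=\mathbf e+(q-1)\mathbb Z^n$, and assume $U_M\ne\emptyset$. For $l=0,\dots,n-m$ let $M_l\subseteq M$ be the set of points of $M$ whose $j$-th coordinate is nonzero for exactly $l$ indices $j\in\{m+1,\dots,n\}$. Then for $l=0,1,\dots,n-m$, $$w_p(M_l)+a(n-m-l)(p-1)\ge w_p(M_{n-m}).$$
   Context: $U^+_{q-1}=\{u\in\mathbb Z^N:0\le u_i\le q-1\ \forall i\}$; for $u\in U^+_{q-1}$ with base-$p$ digits $u_i=\sum_{k=0}^{a-1}u^{(k)}_ip^k$ ($0\le u^{(k)}_i\le p-1$), the $p$-weight is $w_p(u)=\sum_{i=1}^N\sum_{k=0}^{a-1}u^{(k)}_i$. For $X\subseteq\mathbb Z^n$, $U_X=\{u\in U^+_{q-1}:\sum_iu_i\mathbf a_i\in X\}$ and $w_p(X)=\min\{w_p(u):u\in U_X\}$, with the convention $w_p(X)=+\infty$ if $U_X=\emptyset$. -}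

module Defs where

open import Data.Nat as ℕ using (ℕ; zero; suc; _∸_; _^_; _≤_; NonZero)
open import Data.Nat.DivMod using (_/_; _%_)
open import Data.Integer as ℤ using (ℤ; +_)
open import Data.Integer.Divisibility.Signed using (_∣_; _∣?_)
open import Data.Fin using (Fin; toℕ)
import Data.Fin as Fin
open import Data.Fin.Properties using (all?)
open import Data.Vec using (Vec; []; _∷_; lookup)
open import Data.List using (List; []; _∷_; map; concatMap; upTo; filter; allFin)
open import Data.Nat.ListAction using (sum)
open import Data.Product using (_×_; _,_)
open import Relation.Nullary using (Dec; yes; no; ¬_; ¬?; does)
open import Relation.Nullary.Decidable using (_×-dec_; _→-dec_)
open import Relation.Binary.PropositionalEquality using (_≡_; _≢_)
open import Relation.Unary using (Pred; Decidable)
open import Data.Bool using (if_then_else_)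

-- Extended naturals ℕ ∪ {+∞}, used for the value w_p(X) (= +∞ when U_X = ∅).
data ℕ∞ : Set where
  fin : ℕ → ℕ∞
  ∞   : ℕ∞

infix 4 _≤∞_
data _≤∞_ : ℕ∞ → ℕ∞ → Set where
  fin≤fin : ∀ {a b} → a ≤ b → fin a ≤∞ fin b
  ≤∞-top  : ∀ {x} → x ≤∞ ∞

infixl 6 _+∞_
_+∞_ : ℕ∞ → ℕ → ℕ∞
fin a +∞ c = fin (a ℕ.+ c)
∞     +∞ c = ∞

min∞ : ℕ∞ → ℕ∞ → ℕ∞
min∞ (fin a) (fin b) = fin (a ℕ.⊓ b)
min∞ (fin a) ∞       = fin a
min∞ ∞       y       = y

minimum∞ : List ℕ → ℕ∞
minimum∞ []       = ∞
minimum∞ (x ∷ xs) = min∞ (fin x) (minimum∞ xs)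

digitSum : (p : ℕ) → .{{NonZero p}} → (k x : ℕ) → ℕ
digitSum p zero    x = 0
digitSum p (suc k) x = x % p ℕ.+ digitSum p k (x / p)

wt : (p : ℕ) → .{{NonZero p}} → (a : ℕ) → ∀ {N} → Vec ℕ N → ℕ
wt p a []       = 0
wt p a (x ∷ u) = digitSum p a x ℕ.+ wt p a u

InU : (b : ℕ) → ∀ {N} → Vec ℕ N → Set
InU b {N} u = (i : Fin N) → lookup u i ≤ b

allU : (N b : ℕ) → List (Vec ℕ N)
allU zero    b = [] ∷ []
allU (suc N) b = concatMap (λ x → map (x ∷_) (allU N b)) (upTo (suc b))

-- Σ_i u_i a_i ∈ ℤ^n, where the family A = (a_1,...,a_N) is given as A i j = j-th coordinate of a_i
lincomb : ∀ {N n} → Vec ℕ N → (Fin N → Fin n → ℤ) → Fin n → ℤ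
lincomb []       A j = + 0
lincomb (x ∷ u) A j = (+ x) ℤ.* A Fin.zero j ℤ.+ lincomb u (λ i → A (Fin.suc i)) j

InUX : (b : ℕ) → ∀ {N n} → (Fin N → Fin n → ℤ) → Pred (Fin n → ℤ) _ → Vec ℕ N → Set
InUX b A X u = InU b u × X (lincomb u A)

wp : (p : ℕ) → .{{NonZero p}} → (a : ℕ) → ∀ {N n} → (Fin N → Fin n → ℤ)
   → (X : Pred (Fin n → ℤ) Agda.Primitive.lzero) → Decidable X → ℕ∞
wp p a {N} A X X? =
  minimum∞ (map (wt p a) (filter (λ u → X? (lincomb u A)) (allU N (p ^ a ∸ 1))))

InM : (q : ℕ) → ∀ {n} → (e : Fin n → ℤ) → Pred (Fin n → ℤ) Agda.Primitive.lzero
InM q e x = ∀ j → (+ (q ∸ 1)) ∣ (x j ℤ.- e j)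

InM? : (q : ℕ) → ∀ {n} → (e : Fin n → ℤ) → Decidable (InM q e)
InM? q e x = all? (λ j → (+ (q ∸ 1)) ∣? (x j ℤ.- e j))

-- number of indices j ∈ {m+1,...,n} (0-based: m ≤ toℕ j) with x_j ≠ 0
nzCount : (m : ℕ) → ∀ {n} → (Fin n → ℤ) → ℕ
nzCount m {n} x =
  sum (map (λ j → if does (m ℕ.≤? toℕ j) then (if does (x j ℤ.≟ + 0) then 0 else 1) else 0)
           (allFin n))

InMl : (q m l : ℕ) → ∀ {n} → (e : Fin n → ℤ) → Pred (Fin n → ℤ) Agda.Primitive.lzero
InMl q m l e x = InM q e x × nzCount m x ≡ l

InMl? : (q m l : ℕ) → ∀ {n} → (e : Fin n → ℤ) → Decidable (InMl q m l e)
InMl? q m l e x = InM? q e x ×-dec (nzCount m x ℕ.≟ l)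

-- Let u ∈ U_{M_l}.  Every vanishing tail coordinate j of Σ u_i a_i
-- can be switched on: pick a_i with nonzero j-th coordinate; as the tail columns of A are
-- nonnegative, u_i = 0, and raising u_i to q - 1 moves the sum by (q - 1) a_i, so it stays
-- in M, keeps every nonzero tail coordinate nonzero, and costs at most a(p - 1) in weight.
-- After n - m - l such steps the sum lies in M_{n-m}.
module Submission where

open import Defs
open import Data.Nat using (ℕ; _∸_; _^_; _*_; _≤_; _<_; NonZero)
open import Data.Nat.Primality using (Prime)
open import Data.Integer using (ℤ; +_) renaming (_≤_ to _ℤ≤_)
open import Data.Empty using (⊥)
open import Data.Vec using (Vec)
open import Data.Fin using (Fin; toℕ)
open import Data.Product using (Σ; _×_)
open import Function.Definitions using (Injective)
open import Relation.Binary.PropositionalEquality using (_≡_)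

open import Data.Bool using (if_then_else_)
open import Data.Nat as ℕ using (zero; suc; z≤n; s≤s; _≤?_)
import Data.Nat.Properties as ℕP
open import Data.Nat.DivMod using (_/_; m%n<n)
open import Data.Nat.ListAction using (sum)
import Data.Integer as ℤ
open import Data.Integer using (0ℤ; +≤+)
import Data.Integer.Properties as ℤP
open import Data.Integer.Divisibility.Signed using (_∣_; ∣m∣n⇒∣m+n; ∣m⇒∣m*n; ∣-refl)
import Data.Integer.Tactic.RingSolver as ℤSolver
import Data.Fin as Fin
open import Data.Fin.Properties using (any?)
open import Data.Vec using ([]; _∷_; lookup; _[_]≔_)
open import Data.Vec.Properties using (lookup∘update; lookup∘update′)
open import Data.List using (List; []; _∷_; map; filter; allFin; upTo)
import Data.List.Properties as ListP
open import Data.List.Membership.Propositional using (_∈_; find)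
open import Data.List.Membership.Propositional.Properties
  using (∈-allFin; ∈-map⁺; ∈-map⁻; ∈-filter⁺; ∈-filter⁻; ∈-concatMap⁺; ∈-concatMap⁻; ∈-upTo⁺; ∈-upTo⁻)
open import Data.List.Relation.Unary.Any using (here; there)
import Data.List.Relation.Unary.Any as Any
open import Data.Product using (∃; _,_; proj₁; proj₂)
open import Data.Sum using (inj₁; inj₂)
open import Function using (_∘_)
open import Relation.Nullary using (Dec; yes; no; does; contradiction)
open import Relation.Nullary.Decidable using (_×-dec_)
open import Relation.Unary using (Pred; Decidable)
open import Agda.Primitive using (lzero)
open import Relation.Binary.PropositionalEquality
  using (_≢_; refl; sym; trans; cong; subst; module ≡-Reasoning)

private
  variable
    A : Set
    n N : ℕ

sum-map-mono : ∀ {f g : A → ℕ} (xs : List A) → (∀ x → f x ≤ g x) → sum (map f xs) ≤ sum (map g xs)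
sum-map-mono []       f≤g = z≤n
sum-map-mono (x ∷ xs) f≤g = ℕP.+-mono-≤ (f≤g x) (sum-map-mono xs f≤g)

sum-map-mono-< : ∀ {f g : A → ℕ} {xs : List A} {y} → (∀ x → f x ≤ g x) → y ∈ xs → f y < g y →
                 sum (map f xs) < sum (map g xs)
sum-map-mono-< {xs = x ∷ xs} f≤g (here refl) fy<gy = ℕP.+-mono-<-≤ fy<gy (sum-map-mono xs f≤g)
sum-map-mono-< {xs = x ∷ xs} f≤g (there y∈xs) fy<gy = ℕP.+-mono-≤-< (f≤g x) (sum-map-mono-< f≤g y∈xs fy<gy)

sum-map-cong : ∀ {f g : A → ℕ} (xs : List A) → (∀ x → f x ≡ g x) → sum (map f xs) ≡ sum (map g xs)
sum-map-cong xs f≗g = cong sum (ListP.map-cong f≗g xs)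

sum-map-allFin-suc : ∀ n (f : Fin (suc n) → ℕ) →
                     sum (map f (allFin (suc n))) ≡ f Fin.zero ℕ.+ sum (map (f ∘ Fin.suc) (allFin n))
sum-map-allFin-suc n f =
  cong (λ xs → f Fin.zero ℕ.+ sum xs)
       (trans (ListP.map-tabulate Fin.suc f) (sym (ListP.map-tabulate (λ j → j) (f ∘ Fin.suc))))

if-then-0-mono : ∀ {P : Set} (P? : Dec P) {k l} → (P → k ≤ l) →
                 (if does P? then k else 0) ≤ (if does P? then l else 0)
if-then-0-mono (yes p) k≤l = k≤l p
if-then-0-mono (no _)  k≤l = z≤n

if-then-0-cong : ∀ {P : Set} (P? : Dec P) {k l} → (P → k ≡ l) →
                 (if does P? then k else 0) ≡ (if does P? then l else 0)
if-then-0-cong (yes p) k≡l = k≡l p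
if-then-0-cong (no _)  k≡l = refl

if-then-0-mono-< : ∀ {P : Set} (P? : Dec P) {k l} → P → k < l →
                   (if does P? then k else 0) < (if does P? then l else 0)
if-then-0-mono-< (yes _) p k<l = k<l
if-then-0-mono-< (no ¬p) p k<l = contradiction p ¬p

nonzeroIndicator : ℤ → ℕ
nonzeroIndicator x = if does (x ℤ.≟ + 0) then 0 else 1

nonzeroIndicator≤1 : ∀ x → nonzeroIndicator x ≤ 1
nonzeroIndicator≤1 x with x ℤ.≟ + 0
... | yes _ = z≤n
... | no  _ = ℕP.≤-refl

nonzeroIndicator-≢0 : ∀ {x} → x ≢ + 0 → nonzeroIndicator x ≡ 1
nonzeroIndicator-≢0 {x} x≢0 with x ℤ.≟ + 0
... | yes x≡0 = contradiction x≡0 x≢0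
... | no  _   = refl

nonzeroIndicator-mono : ∀ {x y} → (x ≢ + 0 → y ≢ + 0) → nonzeroIndicator x ≤ nonzeroIndicator y
nonzeroIndicator-mono {x} {y} x≢0⇒y≢0 with x ℤ.≟ + 0
... | yes _   = z≤n
... | no  x≢0 = ℕP.≤-reflexive (sym (nonzeroIndicator-≢0 (x≢0⇒y≢0 x≢0)))

nonzeroIndicator-mono-< : ∀ {x y} → x ≡ + 0 → y ≢ + 0 → nonzeroIndicator x < nonzeroIndicator y
nonzeroIndicator-mono-< refl y≢0 = ℕP.≤-reflexive (sym (nonzeroIndicator-≢0 y≢0))

tailIndicator : (m : ℕ) → Fin n → ℕ
tailIndicator m j = if does (m ≤? toℕ j) then 1 else 0

does-suc-≤? : ∀ m k → does (suc m ≤? suc k) ≡ does (m ≤? k)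
does-suc-≤? zero    k = refl
does-suc-≤? (suc m) k = refl

sum-tailIndicator : ∀ n m → sum (map (tailIndicator m) (allFin n)) ≡ n ∸ m
sum-tailIndicator zero    zero    = refl
sum-tailIndicator zero    (suc m) = refl
sum-tailIndicator (suc n) zero    =
  trans (sum-map-allFin-suc n (tailIndicator 0)) (cong suc (sum-tailIndicator n 0))
sum-tailIndicator (suc n) (suc m) = begin
  sum (map (tailIndicator (suc m)) (allFin (suc n)))        ≡⟨ sum-map-allFin-suc n (tailIndicator (suc m)) ⟩
  sum (map (tailIndicator (suc m) ∘ Fin.suc) (allFin n))    ≡⟨ sum-map-cong (allFin n) shift ⟩
  sum (map (tailIndicator m) (allFin n))                    ≡⟨ sum-tailIndicator n m ⟩
  n ∸ m                                                     ∎
  where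
  open ≡-Reasoning
  shift : ∀ j → tailIndicator (suc m) (Fin.suc j) ≡ tailIndicator m j
  shift j = cong (λ b → if b then 1 else 0) (does-suc-≤? m (toℕ j))

nzCount≤ : ∀ m (x : Fin n → ℤ) → nzCount m x ≤ n ∸ m
nzCount≤ {n} m x =
  ℕP.≤-trans (sum-map-mono (allFin n) (λ j → if-then-0-mono (m ≤? toℕ j) (λ _ → nonzeroIndicator≤1 (x j))))
             (ℕP.≤-reflexive (sum-tailIndicator n m))

nzCount-full : ∀ m (x : Fin n → ℤ) → (∀ j → m ≤ toℕ j → x j ≢ + 0) → nzCount m x ≡ n ∸ m
nzCount-full {n} m x x≢0 =
  trans (sum-map-cong (allFin n) (λ j → if-then-0-cong (m ≤? toℕ j) (nonzeroIndicator-≢0 ∘ x≢0 j)))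
        (sum-tailIndicator n m)

nzCount-mono-< : ∀ m (x y : Fin n → ℤ) → (∀ j → m ≤ toℕ j → x j ≢ + 0 → y j ≢ + 0) →
                 ∀ j → m ≤ toℕ j → x j ≡ + 0 → y j ≢ + 0 → nzCount m x < nzCount m y
nzCount-mono-< m x y x≢0⇒y≢0 j m≤j x≡0 y≢0 =
  sum-map-mono-< (λ k → if-then-0-mono (m ≤? toℕ k) (λ m≤k → nonzeroIndicator-mono (x≢0⇒y≢0 k m≤k)))
                 (∈-allFin j)
                 (if-then-0-mono-< (m ≤? toℕ j) m≤j (nonzeroIndicator-mono-< x≡0 y≢0))

nonneg-+≡0 : ∀ {i k} → 0ℤ ℤ≤ i → 0ℤ ℤ≤ k → i ℤ.+ k ≡ 0ℤ → i ≡ 0ℤ × k ≡ 0ℤ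
nonneg-+≡0 {+ i} {+ k} (+≤+ _) (+≤+ _) i+k≡0 =
  cong +_ (ℕP.m+n≡0⇒m≡0 i (ℤP.+-injective i+k≡0)) , cong +_ (ℕP.m+n≡0⇒n≡0 i (ℤP.+-injective i+k≡0))

nonneg-* : ∀ x {i} → 0ℤ ℤ≤ i → 0ℤ ℤ≤ + x ℤ.* i
nonneg-* x {+ k} (+≤+ _) = subst (0ℤ ℤ≤_) (ℤP.pos-* x k) (+≤+ z≤n)

lincomb-nonneg : (u : Vec ℕ N) (A : Fin N → Fin n → ℤ) (j : Fin n) →
                 (∀ i → 0ℤ ℤ≤ A i j) → 0ℤ ℤ≤ lincomb u A j
lincomb-nonneg []      A j A≥0 = +≤+ z≤n
lincomb-nonneg (x ∷ u) A j A≥0 =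
  ℤP.+-mono-≤ (nonneg-* x (A≥0 Fin.zero)) (lincomb-nonneg u (A ∘ Fin.suc) j (A≥0 ∘ Fin.suc))

lincomb≡0⇒lookup≡0 : (u : Vec ℕ N) (A : Fin N → Fin n → ℤ) (j : Fin n) → (∀ i → 0ℤ ℤ≤ A i j) →
                     lincomb u A j ≡ 0ℤ → ∀ i → A i j ≢ 0ℤ → lookup u i ≡ 0
lincomb≡0⇒lookup≡0 (x ∷ u) A j A≥0 u·A≡0 i A≢0
  with nonneg-+≡0 (nonneg-* x (A≥0 Fin.zero)) (lincomb-nonneg u (A ∘ Fin.suc) j (A≥0 ∘ Fin.suc)) u·A≡0
lincomb≡0⇒lookup≡0 (x ∷ u) A j A≥0 u·A≡0 Fin.zero    A≢0 | x·A≡0 , _ with ℤP.i*j≡0⇒i≡0∨j≡0 (+ x) x·A≡0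
... | inj₁ x≡0 = ℤP.+-injective x≡0
... | inj₂ A≡0 = contradiction A≡0 A≢0
lincomb≡0⇒lookup≡0 (x ∷ u) A j A≥0 u·A≡0 (Fin.suc i) A≢0 | _ , rest≡0 =
  lincomb≡0⇒lookup≡0 u (A ∘ Fin.suc) j (A≥0 ∘ Fin.suc) rest≡0 i A≢0

lincomb-update : (u : Vec ℕ N) (A : Fin N → Fin n → ℤ) (i : Fin N) (v : ℕ) (j : Fin n) →
                 lookup u i ≡ 0 → lincomb (u [ i ]≔ v) A j ≡ lincomb u A j ℤ.+ + v ℤ.* A i j
lincomb-update (.0 ∷ u) A Fin.zero v j refl =
  trans (ℤP.+-comm (+ v ℤ.* A Fin.zero j) (lincomb u (A ∘ Fin.suc) j))
        (cong (ℤ._+ (+ v ℤ.* A Fin.zero j)) (sym (ℤP.+-identityˡ (lincomb u (A ∘ Fin.suc) j))))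
lincomb-update (x ∷ u) A (Fin.suc i) v j uᵢ≡0 =
  trans (cong (ℤ._+_ (+ x ℤ.* A Fin.zero j)) (lincomb-update u (A ∘ Fin.suc) i v j uᵢ≡0))
        (sym (ℤP.+-assoc (+ x ℤ.* A Fin.zero j) (lincomb u (A ∘ Fin.suc) j) (+ v ℤ.* A (Fin.suc i) j)))

InU-update : ∀ {b v} (u : Vec ℕ N) (i : Fin N) → InU b u → v ≤ b → InU b (u [ i ]≔ v)
InU-update {b = b} {v} u i u∈U v≤b k with i Fin.≟ k
... | yes refl = subst (_≤ b) (sym (lookup∘update i u v)) v≤b
... | no  i≢k  = subst (_≤ b) (sym (lookup∘update′ (i≢k ∘ sym) u v)) (u∈U k)

digitSum≤ : (p : ℕ) .{{_ : NonZero p}} (k x : ℕ) → digitSum p k x ≤ k * (p ∸ 1)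
digitSum≤ p       zero    x = z≤n
digitSum≤ (suc p) (suc k) x =
  ℕP.+-mono-≤ (ℕP.≤-pred (m%n<n x (suc p))) (digitSum≤ (suc p) k (x / suc p))

wt-update : (p : ℕ) .{{_ : NonZero p}} (a : ℕ) (u : Vec ℕ N) (i : Fin N) (v : ℕ) →
            wt p a (u [ i ]≔ v) ≤ wt p a u ℕ.+ digitSum p a v
wt-update p a (x ∷ u) Fin.zero v =
  ℕP.≤-trans (ℕP.≤-reflexive (ℕP.+-comm (digitSum p a v) (wt p a u)))
             (ℕP.+-monoˡ-≤ (digitSum p a v) (ℕP.m≤n+m (wt p a u) (digitSum p a x)))
wt-update p a (x ∷ u) (Fin.suc i) v =
  ℕP.≤-trans (ℕP.+-monoʳ-≤ (digitSum p a x) (wt-update p a u i v))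
             (ℕP.≤-reflexive (sym (ℕP.+-assoc (digitSum p a x) (wt p a u) (digitSum p a v))))

InM-shift : ∀ q (e x y z : Fin n → ℤ) → InM q e x → (∀ j → y j ≡ x j ℤ.+ + (q ∸ 1) ℤ.* z j) → InM q e y
InM-shift q e x y z x∈M y≡x+dz j =
  subst (λ w → + (q ∸ 1) ∣ (w ℤ.- e j)) (sym (y≡x+dz j))
        (subst (+ (q ∸ 1) ∣_) (+-−-comm (x j) (+ (q ∸ 1) ℤ.* z j) (e j))
               (∣m∣n⇒∣m+n (x∈M j) (∣m⇒∣m*n (z j) ∣-refl)))
  where
  +-−-comm : ∀ x t e → (x ℤ.- e) ℤ.+ t ≡ (x ℤ.+ t) ℤ.- e
  +-−-comm = ℤSolver.solve-∀

≤∞-fin-trans : ∀ {z k l} → z ≤∞ fin k → k ≤ l → z ≤∞ fin l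
≤∞-fin-trans (fin≤fin w≤k) k≤l = fin≤fin (ℕP.≤-trans w≤k k≤l)

min∞-≤ˡ : ∀ x b → min∞ (fin x) b ≤∞ fin x
min∞-≤ˡ x (fin y) = fin≤fin (ℕP.m⊓n≤m x y)
min∞-≤ˡ x ∞       = fin≤fin ℕP.≤-refl

min∞-≤ʳ : ∀ x {b k} → b ≤∞ fin k → min∞ (fin x) b ≤∞ fin k
min∞-≤ʳ x (fin≤fin y≤k) = fin≤fin (ℕP.≤-trans (ℕP.m⊓n≤n x _) y≤k)

min∞-glb-+∞ : ∀ {z} a b c → z ≤∞ a +∞ c → z ≤∞ b +∞ c → z ≤∞ min∞ a b +∞ c
min∞-glb-+∞ (fin x) (fin y) c (fin≤fin w≤x+c) (fin≤fin w≤y+c) =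
  fin≤fin (ℕP.≤-trans (ℕP.⊓-glb w≤x+c w≤y+c) (ℕP.≤-reflexive (sym (ℕP.+-distribʳ-⊓ c x y))))
min∞-glb-+∞ (fin x) ∞ c z≤x+c _ = z≤x+c
min∞-glb-+∞ ∞       b c _ z≤b+c = z≤b+c

minimum∞≤ : ∀ {k} (xs : List ℕ) → k ∈ xs → minimum∞ xs ≤∞ fin k
minimum∞≤ (x ∷ xs) (here refl)  = min∞-≤ˡ x (minimum∞ xs)
minimum∞≤ (x ∷ xs) (there k∈xs) = min∞-≤ʳ x (minimum∞≤ xs k∈xs)

minimum∞-transfer : ∀ (xs ys : List ℕ) c → (∀ {k} → k ∈ xs → ∃ λ k′ → k′ ∈ ys × k′ ≤ k ℕ.+ c) →
                    minimum∞ ys ≤∞ minimum∞ xs +∞ c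
minimum∞-transfer []       ys c _ = ≤∞-top
minimum∞-transfer (x ∷ xs) ys c dominated =
  min∞-glb-+∞ (fin x) (minimum∞ xs) c
    (let k′ , k′∈ys , k′≤x+c = dominated (here refl) in ≤∞-fin-trans (minimum∞≤ ys k′∈ys) k′≤x+c)
    (minimum∞-transfer xs ys c (dominated ∘ there))

∈-allU⁻ : ∀ N b {u : Vec ℕ N} → u ∈ allU N b → InU b u
∈-allU⁻ zero    b {[]}    _ ()
∈-allU⁻ (suc N) b {x ∷ u} x∷u∈ with find (∈-concatMap⁻ (λ y → map (y ∷_) (allU N b)) {xs = upTo (suc b)} x∷u∈)
... | y , y∈upTo , x∷u∈map with ∈-map⁻ (y ∷_) x∷u∈map
... | v , v∈allU , refl = λ where
  Fin.zero    → ℕP.≤-pred (∈-upTo⁻ y∈upTo)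
  (Fin.suc i) → ∈-allU⁻ N b v∈allU i

∈-allU⁺ : ∀ N b {u : Vec ℕ N} → InU b u → u ∈ allU N b
∈-allU⁺ zero    b {[]}    _   = here refl
∈-allU⁺ (suc N) b {x ∷ u} x∷u∈U =
  ∈-concatMap⁺ (λ y → map (y ∷_) (allU N b))
    (Any.map (λ { refl → ∈-map⁺ (x ∷_) (∈-allU⁺ N b (x∷u∈U ∘ Fin.suc)) }) (∈-upTo⁺ (s≤s (x∷u∈U Fin.zero))))

wp-transfer : (p : ℕ) .{{_ : NonZero p}} (a : ℕ) (A : Fin N → Fin n → ℤ)
  (X Y : Pred (Fin n → ℤ) lzero) (X? : Decidable X) (Y? : Decidable Y) (c : ℕ) →
  (∀ u → InUX (p ^ a ∸ 1) A X u → ∃ λ u′ → InUX (p ^ a ∸ 1) A Y u′ × wt p a u′ ≤ wt p a u ℕ.+ c) →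
  wp p a A Y Y? ≤∞ wp p a A X X? +∞ c
wp-transfer {N} p a A X Y X? Y? c dominated = minimum∞-transfer _ _ c weight∈
  where
  weight∈ : ∀ {k} → k ∈ map (wt p a) (filter (λ u → X? (lincomb u A)) (allU N (p ^ a ∸ 1))) →
            ∃ λ k′ → k′ ∈ map (wt p a) (filter (λ u → Y? (lincomb u A)) (allU N (p ^ a ∸ 1))) × k′ ≤ k ℕ.+ c
  weight∈ k∈ with ∈-map⁻ (wt p a) k∈
  ... | u , u∈ , refl with ∈-filter⁻ (λ u → X? (lincomb u A)) {xs = allU N (p ^ a ∸ 1)} u∈
  ... | u∈allU , u·A∈X with dominated u (∈-allU⁻ N _ u∈allU , u·A∈X)
  ... | u′ , (u′∈U , u′·A∈Y) , wt-u′ =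
    wt p a u′ , ∈-map⁺ (wt p a) (∈-filter⁺ (λ u → Y? (lincomb u A)) {x = u′} (∈-allU⁺ N _ u′∈U) u′·A∈Y) , wt-u′

p^a∸1>0 : ∀ p a → Prime p → 1 ≤ a → 0 < p ^ a ∸ 1
p^a∸1>0 p (suc a) (Data.Nat.Primality.prime _) _ =
  ℕP.m<n⇒0<n∸m (ℕP.*-mono-≤ (ℕ.nonTrivial⇒n>1 p) (ℕP.m^n>0 p {{ℕ.nonTrivial⇒nonZero p}} a))

module Filling (p a q : ℕ) .{{_ : NonZero p}} (m : ℕ) {N n : ℕ} (A : Fin N → Fin n → ℤ)
  (tail-nonneg : ∀ i j → m ≤ toℕ j → 0ℤ ℤ≤ A i j)
  (tail-covered : ∀ j → m ≤ toℕ j → Σ (Fin N) (λ i → A i j ≢ 0ℤ))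
  (e : Fin n → ℤ) (q∸1>0 : 0 < q ∸ 1) where

  fill-coordinate : ∀ u → InUX (q ∸ 1) A (InM q e) u → ∀ j → m ≤ toℕ j → lincomb u A j ≡ 0ℤ →
    ∃ λ u′ → InUX (q ∸ 1) A (InM q e) u′
           × nzCount m (lincomb u A) < nzCount m (lincomb u′ A)
           × wt p a u′ ≤ wt p a u ℕ.+ a * (p ∸ 1)
  fill-coordinate u (u∈U , u·A∈M) j m≤j u·Aⱼ≡0 =
    u′ , (InU-update u i u∈U ℕP.≤-refl , InM-shift q e (lincomb u A) (lincomb u′ A) (A i) u·A∈M shift) ,
    nzCount-mono-< m (lincomb u A) (lincomb u′ A) stays-nonzero j m≤j u·Aⱼ≡0 becomes-nonzero ,
    ℕP.≤-trans (wt-update p a u i (q ∸ 1)) (ℕP.+-monoʳ-≤ (wt p a u) (digitSum≤ p a (q ∸ 1)))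
    where
    i = proj₁ (tail-covered j m≤j)
    Aᵢⱼ≢0 = proj₂ (tail-covered j m≤j)
    u′ = u [ i ]≔ (q ∸ 1)

    shift : ∀ k → lincomb u′ A k ≡ lincomb u A k ℤ.+ + (q ∸ 1) ℤ.* A i k
    shift k = lincomb-update u A i (q ∸ 1) k
                (lincomb≡0⇒lookup≡0 u A j (λ i → tail-nonneg i j m≤j) u·Aⱼ≡0 i Aᵢⱼ≢0)

    summands≡0 : ∀ k → m ≤ toℕ k → lincomb u′ A k ≡ 0ℤ →
                 lincomb u A k ≡ 0ℤ × + (q ∸ 1) ℤ.* A i k ≡ 0ℤ
    summands≡0 k m≤k u′·Aₖ≡0 =
      nonneg-+≡0 (lincomb-nonneg u A k (λ i → tail-nonneg i k m≤k)) (nonneg-* (q ∸ 1) (tail-nonneg i k m≤k))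
                 (trans (sym (shift k)) u′·Aₖ≡0)

    stays-nonzero : ∀ k → m ≤ toℕ k → lincomb u A k ≢ 0ℤ → lincomb u′ A k ≢ 0ℤ
    stays-nonzero k m≤k u·Aₖ≢0 = u·Aₖ≢0 ∘ proj₁ ∘ summands≡0 k m≤k

    becomes-nonzero : lincomb u′ A j ≢ 0ℤ
    becomes-nonzero u′·Aⱼ≡0 with ℤP.i*j≡0⇒i≡0∨j≡0 (+ (q ∸ 1)) (proj₂ (summands≡0 j m≤j u′·Aⱼ≡0))
    ... | inj₁ q∸1≡0 = ℕP.<⇒≢ q∸1>0 (sym (ℤP.+-injective q∸1≡0))
    ... | inj₂ Aᵢⱼ≡0 = Aᵢⱼ≢0 Aᵢⱼ≡0

  fill-all : ∀ k u → InUX (q ∸ 1) A (InM q e) u → n ∸ m ≤ nzCount m (lincomb u A) ℕ.+ k →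
    ∃ λ u′ → InUX (q ∸ 1) A (InMl q m (n ∸ m) e) u′ × wt p a u′ ≤ wt p a u ℕ.+ k * (a * (p ∸ 1))
  fill-all zero u (u∈U , u·A∈M) n∸m≤count =
    u , (u∈U , u·A∈M , ℕP.≤-antisym (nzCount≤ m (lincomb u A))
                                      (ℕP.≤-trans n∸m≤count (ℕP.≤-reflexive (ℕP.+-identityʳ _)))) ,
    ℕP.m≤m+n (wt p a u) 0
  fill-all (suc k) u u∈U_M@(u∈U , u·A∈M) n∸m≤count+k
    with any? (λ j → (m ≤? toℕ j) ×-dec (lincomb u A j ℤ.≟ 0ℤ))
  ... | no no-zero =
    u , (u∈U , u·A∈M , nzCount-full m (lincomb u A) (λ j m≤j u·Aⱼ≡0 → no-zero (j , m≤j , u·Aⱼ≡0))) ,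
    ℕP.m≤m+n (wt p a u) _
  ... | yes (j , m≤j , u·Aⱼ≡0) with fill-coordinate u u∈U_M j m≤j u·Aⱼ≡0
  ... | u₁ , u₁∈U_M , count< , wt-u₁ with fill-all k u₁ u₁∈U_M
          (ℕP.≤-trans n∸m≤count+k (ℕP.≤-trans (ℕP.≤-reflexive (ℕP.+-suc _ k)) (ℕP.+-monoˡ-≤ k count<)))
  ... | u′ , u′∈U_Ml , wt-u′ =
    u′ , u′∈U_Ml ,
    ℕP.≤-trans wt-u′ (ℕP.≤-trans (ℕP.+-monoˡ-≤ (k * (a * (p ∸ 1))) wt-u₁)
                                 (ℕP.≤-reflexive (ℕP.+-assoc (wt p a u) (a * (p ∸ 1)) (k * (a * (p ∸ 1))))))

lemma7p6 : (p a : ℕ) → .{{_ : NonZero p}} → Prime p → 1 ≤ a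
    → (m n N : ℕ) → m ≤ n
    → (A : Fin N → Fin n → ℤ)
    → Injective _≡_ _≡_ A
    → (∀ i j → m ≤ toℕ j → +_ 0 ℤ≤ A i j)
    → (∀ (j : Fin n) → m ≤ toℕ j → Σ (Fin N) (λ i → A i j ≡ +_ 0 → ⊥))
    → (e : Fin n → ℤ)
    → (∀ j → m ≤ toℕ j → e j ≡ +_ 0)
    → Σ (Vec ℕ N) (λ u → InUX (p ^ a ∸ 1) A (InM (p ^ a) e) u)
    → (l : ℕ) → l ≤ n ∸ m
    → wp p a A (InMl (p ^ a) m (n ∸ m) e) (InMl? (p ^ a) m (n ∸ m) e)
        ≤∞ wp p a A (InMl (p ^ a) m l e) (InMl? (p ^ a) m l e) +∞ (a * (n ∸ m ∸ l) * (p ∸ 1))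
lemma7p6 p a p-prime a≥1 m n N _ A _ tail-nonneg tail-covered e _ _ l _ =
  wp-transfer p a A _ _ (InMl? (p ^ a) m l e) (InMl? (p ^ a) m (n ∸ m) e) _ fill
  where
  open Filling p a (p ^ a) m A tail-nonneg tail-covered e (p^a∸1>0 p a p-prime a≥1)
  k = n ∸ m ∸ l

  cost : k * (a * (p ∸ 1)) ≡ a * k * (p ∸ 1)
  cost = trans (sym (ℕP.*-assoc k a (p ∸ 1))) (cong (_* (p ∸ 1)) (ℕP.*-comm k a))

  fill : ∀ u → InUX (p ^ a ∸ 1) A (InMl (p ^ a) m l e) u →
         ∃ λ u′ → InUX (p ^ a ∸ 1) A (InMl (p ^ a) m (n ∸ m) e) u′ × wt p a u′ ≤ wt p a u ℕ.+ a * k * (p ∸ 1)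
  fill u (u∈U , u·A∈M , count≡l) with fill-all k u (u∈U , u·A∈M)
                                        (subst (λ c → n ∸ m ≤ c ℕ.+ k) (sym count≡l) (ℕP.m≤n+m∸n (n ∸ m) l))
  ... | u′ , u′∈U_Mₙ₋ₘ , wt-u′ = u′ , u′∈U_Mₙ₋ₘ , subst (λ c → wt p a u′ ≤ wt p a u ℕ.+ c) cost wt-u′
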